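{- Let $G$ be an $n$-vertex graph, $M=\{v_1,\dots,v_k\}$ a clique modulator of $G$, $Q=V(G)\setminus M$, and $A_1,\dots,A_\ell$ the equivalence classes of $Q$. Let $\sigma_M$ be a permutation of $M$, and for each $i\in[k+1]$ let $g_i:[\ell]\to\{A_1,\dots,A_\ell\}$ be a bijection with $\mathrm{rm}_{\sigma_M}(g_i(1),i)\ge \mathrm{rm}_{\sigma_M}(g_i(2),i)\ge\dots\ge \mathrm{rm}_{\sigma_M}(g_i(\ell),i)$. Let $\sigma$ be any ordering of $V(G)$ whose restriction to $M$ is $\sigma_M$, and for $i\in[k+1]$ let $Y_i$ be the set of vertices of $Q$ in block $i$ of $\sigma$. Let $\widehat{\sigma}$ be the ordering of $V(G)$ of the form $$\widehat{\sigma}_1(Y_1)\prec \sigma_M^{ -1}(1)\prec \widehat{\sigma}_2(Y_2)\prec\dots\prec \sigma_M^{ -1}(k)\prec \widehat{\sigma}_{k+1}(Y_{k+1}),$$ where for each $i\in[k+1]$, $\widehat{\sigma}_i(Y_i)$ lists the vertices of $Y_i$ consecutively with those of $Y_i\cap g_i(1)$ first, then those of $Y_i\cap g_i(2)$, ..., and finally those of $Y_i\cap g_i(\ell)$. Then $\mu_G(\widehat{\sigma})\le\mu_G(\sigma)$.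
   Context: All graphs are finite and simple. For an $n$-vertex graph $G$, an ordering is a bijection $\phi:V(G)\to[n]$; its cost is $\mu_G(\phi)=\sum_{\{u,v\}\in E(G)}\min\{\phi(u),\phi(v)\}$; $x\prec y$ means $x$ is placed before $y$. A set $M\subset V(G)$ is a clique modulator if $G[V(G)\setminus M]$ is a clique. For $u\in Q=V(G)\setminus M$ let $N_M(u)=\{v\in M:\{u,v\}\in E(G)\}$; the equivalence classes of $Q$ are the classes of the relation $u\sim w$ iff $N_M(u)=N_M(w)$. The restriction $\sigma|_M$ of an ordering $\sigma$ is the bijection $M\to[|M|]$ preserving the relative order of $M$ in $\sigma$. For an ordering $\sigma$ with $\sigma|_M=\sigma_M$ and $i\in[k+1]$, block $i$ of $\sigma$ consists of the vertices of $Q$ placed after $\sigma_M^{ -1}(i-1)$ (no condition if $i=1$) and before $\sigma_M^{ -1}(i)$ (no condition if $i=k+1$). For $u\in Q$ and $i\in[k+1]$, the right modulator degree is $\mathrm{rm}_{\sigma_M}(u,i)=|\{v\in N_M(u):\sigma_M(v)\ge i\}|$; it is the same for all vertices of an equivalence class $A$, and is denoted $\mathrm{rm}_{\sigma_M}(A,i)$. -}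

module Defs where

open import Data.Nat using (ℕ; zero; suc; _+_; _<_; _≤_; _≥_; _<ᵇ_; _⊓_)
open import Data.Bool using (Bool; true; false; if_then_else_; _∧_)
open import Data.Fin using (Fin; toℕ)
open import Data.List using (List; map; allFin)
open import Data.Nat.ListAction using (sum)
open import Data.Product using (Σ; ∃; _×_; _,_)
open import Data.Fin.Permutation using (Permutation′; _⟨$⟩ʳ_)
open import Function.Definitions using (Injective)
open import Relation.Binary.PropositionalEquality using (_≡_; _≢_)
open import Relation.Nullary using (¬_)
open import Relation.Nullary.Decidable using (does)
open import Data.Nat using (_≤?_)

record SimpleGraph (n : ℕ) : Set where
  field
    adj    : Fin n → Fin n → Bool
    sym    : ∀ u v → adj u v ≡ adj v u
    irrefl : ∀ u → adj u u ≡ false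

open SimpleGraph public

-- An ordering is a bijection V(G) → [n]; position of u is 1 + toℕ (φ u).
Ordering : ℕ → Set
Ordering n = Permutation′ n

pos : ∀ {n} → Ordering n → Fin n → ℕ
pos φ u = suc (toℕ (φ ⟨$⟩ʳ u))

_⊢_≺_ : ∀ {n} → Ordering n → Fin n → Fin n → Set
φ ⊢ x ≺ y = pos φ x < pos φ y

-- μ_G(φ) = Σ_{edges {u,v}} min(φ u, φ v); each edge counted once (u < v).
cost : ∀ {n} → SimpleGraph n → Ordering n → ℕ
cost {n} G φ =
  sum (map (λ u → sum (map (λ v →
     if adj G u v ∧ (toℕ u <ᵇ toℕ v) then pos φ u ⊓ pos φ v else 0)
     (allFin n))) (allFin n))

-- M = {v_1,…,v_k} given by an injective enumeration m : Fin k → Fin n.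
InM : ∀ {n k} → (Fin k → Fin n) → Fin n → Set
InM m u = ∃ λ j → m j ≡ u

InQ : ∀ {n k} → (Fin k → Fin n) → Fin n → Set
InQ m u = ¬ InM m u

IsCliqueModulator : ∀ {n k} → SimpleGraph n → (Fin k → Fin n) → Set
IsCliqueModulator G m =
  ∀ u v → InQ m u → InQ m v → u ≢ v → adj G u v ≡ true

SameModNbhd : ∀ {n k} → SimpleGraph n → (Fin k → Fin n) → Fin n → Fin n → Set
SameModNbhd G m u w = ∀ j → adj G u (m j) ≡ adj G w (m j)

-- cls labels the equivalence classes A_1,…,A_ℓ of Q by Fin ℓ:
-- every label is used by some vertex of Q, and two vertices of Q
-- get the same label iff they have the same neighbourhood in M.
IsClassLabelling : ∀ {n k ℓ} → SimpleGraph n → (Fin k → Fin n) → (Fin n → Fin ℓ) → Set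
IsClassLabelling G m cls =
    (∀ a → ∃ λ u → InQ m u × cls u ≡ a)
  × (∀ u w → InQ m u → InQ m w → (cls u ≡ cls w → SameModNbhd G m u w)
                                 × (SameModNbhd G m u w → cls u ≡ cls w))

-- σ_M is a permutation of M: σ_M(v_j) = 1 + toℕ (σM ⟨$⟩ʳ j).
-- Restriction of σ to M equals σ_M (σ_M preserves the relative order of M in σ).
RestrictsTo : ∀ {n k} → Ordering n → (Fin k → Fin n) → Permutation′ k → Set
RestrictsTo σ m σM =
  ∀ j j' → (σ ⊢ m j ≺ m j' → toℕ (σM ⟨$⟩ʳ j) < toℕ (σM ⟨$⟩ʳ j'))
         × (toℕ (σM ⟨$⟩ʳ j) < toℕ (σM ⟨$⟩ʳ j') → σ ⊢ m j ≺ m j')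

-- u (a vertex of Q) lies in block i of σ, where b : Fin (k+1) and i = 1 + toℕ b:
-- u is after σ_M^{-1}(i-1) (if i > 1) and before σ_M^{-1}(i) (if i ≤ k).
InBlock : ∀ {n k} → Ordering n → (Fin k → Fin n) → Permutation′ k → Fin n → Fin (suc k) → Set
InBlock σ m σM u b =
    (∀ j → suc (toℕ (σM ⟨$⟩ʳ j)) ≡ toℕ b → σ ⊢ m j ≺ u)
  × (∀ j → toℕ (σM ⟨$⟩ʳ j) ≡ toℕ b → σ ⊢ u ≺ m j)

-- rm_{σ_M}(u, i) = |{v ∈ N_M(u) : σ_M(v) ≥ i}|, with i = 1 + toℕ b.
rm : ∀ {n k} → SimpleGraph n → (Fin k → Fin n) → Permutation′ k → Fin n → Fin (suc k) → ℕ
rm {k = k} G m σM u b =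
  sum (map (λ j → if adj G u (m j) ∧ does (toℕ b ≤? toℕ (σM ⟨$⟩ʳ j)) then 1 else 0)
    (allFin k))

module Submission where

-- Every edge uv contributes one plus the number of vertices placed before both u and v, so,
-- summing over triples, 6 · μ(φ) = 3 · Σ deg + Σ_{x,y,z} w_φ(x,y,z) for a cyclically symmetric
-- weight w_φ that, on distinct x, y, z, is the adjacency of the two vertices placed after the
-- first one.  σ and σ̂ order every pair alike except two vertices of Q sharing a block, so w can
-- only change on triples through such a pair x, y.  If the third vertex z lies in Q the triple is
-- a triangle and w = 1; if z ∈ M precedes the block, w = adj(x,y).  Otherwise z ∈ M follows the
-- block and w is the adjacency of z to the later of x and y; summed over z this is the right
-- modulator degree of the later vertex, which σ̂ never increases since it puts classes of larger
-- right modulator degree first.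

open import Defs hiding (sym)
open import Data.Nat using (ℕ; zero; suc; _+_; _*_; _<_; _≤_; _≥_; _⊓_; _<ᵇ_; z≤n; s≤s; _<?_; _≤?_)
open import Data.Nat.Properties
open import Data.Nat.ListAction using () renaming (sum to listSum)
open import Data.Fin using (Fin; zero; suc; toℕ; fromℕ<) renaming (_≟_ to _≟ᶠ_)
open import Data.Fin.Properties using (toℕ-injective; toℕ<n; toℕ-fromℕ<; any?)
open import Data.Fin.Permutation using (Permutation′; _⟨$⟩ʳ_; _⟨$⟩ˡ_; inverseˡ; inverseʳ; flip)
open import Data.Bool using (Bool; true; false; if_then_else_; _∧_)
open import Data.List using (map; allFin; tabulate)
open import Data.List.Properties using (map-tabulate)
open import Data.Product using (∃; _×_; _,_; proj₁; proj₂)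
open import Data.Sum using (_⊎_; inj₁; inj₂)
open import Data.Empty using (⊥-elim)
open import Function using (_∘_; id)
open import Function.Bundles using (_⇔_; mk⇔; Equivalence; Injection)
open import Function.Properties.Inverse using (↔⇒↣)
open import Function.Definitions using (Injective)
open import Relation.Binary using (tri<; tri≈; tri>)
open import Relation.Binary.PropositionalEquality
open import Relation.Nullary using (¬_; Dec; yes; no; does; contradiction)
open import Relation.Nullary.Decidable using (_×-dec_; ¬?)
open import Algebra.Properties.Semiring.Sum +-*-semiring
  using (sum; sum-cong-≗; ∑-distrib-+; ∑-comm; ∑-permute; *-distribˡ-sum; *-distribʳ-sum)

𝟙 : Bool → ℕ
𝟙 true  = 1
𝟙 false = 0

𝟙-yes : ∀ {p} {P : Set p} (d : Dec P) → P → 𝟙 (does d) ≡ 1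
𝟙-yes (yes _) _ = refl
𝟙-yes (no ¬p) p = ⊥-elim (¬p p)

𝟙-no : ∀ {p} {P : Set p} (d : Dec P) → ¬ P → 𝟙 (does d) ≡ 0
𝟙-no (yes p) ¬p = ⊥-elim (¬p p)
𝟙-no (no _)  _  = refl

𝟙-∧ : ∀ b c → (if b ∧ c then 1 else 0) ≡ 𝟙 c * 𝟙 b
𝟙-∧ false false = refl
𝟙-∧ false true  = refl
𝟙-∧ true  false = refl
𝟙-∧ true  true  = refl

sum-mono-≤ : ∀ {n} {f g : Fin n → ℕ} → (∀ i → f i ≤ g i) → sum f ≤ sum g
sum-mono-≤ {zero}  f≤g = z≤n
sum-mono-≤ {suc n} f≤g = +-mono-≤ (f≤g zero) (sum-mono-≤ (f≤g ∘ suc))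

sum-zero : ∀ {n} {f : Fin n → ℕ} → (∀ i → f i ≡ 0) → sum f ≡ 0
sum-zero {zero}  f≡0 = refl
sum-zero {suc n} f≡0 = cong₂ _+_ (f≡0 zero) (sum-zero (f≡0 ∘ suc))

listSum-allFin : ∀ {n} (f : Fin n → ℕ) → listSum (map f (allFin n)) ≡ sum f
listSum-allFin f = trans (cong listSum (map-tabulate id f)) (listSum-tabulate f)
  where
  listSum-tabulate : ∀ {n} (h : Fin n → ℕ) → listSum (tabulate h) ≡ sum h
  listSum-tabulate {zero}  h = refl
  listSum-tabulate {suc n} h = cong (h zero +_) (listSum-tabulate (h ∘ suc))

δ : ∀ {n} → Fin n → Fin n → ℕ
δ a z = 𝟙 (does (a ≟ᶠ z))

sum-δ : ∀ {n} (a : Fin n) (f : Fin n → ℕ) → sum (λ z → δ a z * f z) ≡ f a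
sum-δ {suc n} zero f = begin
  f zero + 0 + sum {n} (λ z → δ zero (suc z) * f (suc z)) ≡⟨ cong (f zero + 0 +_) (sum-zero {n} λ _ → refl) ⟩
  f zero + 0 + 0                                          ≡⟨ trans (+-identityʳ _) (+-identityʳ _) ⟩
  f zero                                                  ∎
  where open ≡-Reasoning
sum-δ (suc a) f = trans (sum-cong-≗ δ-suc) (sum-δ a (f ∘ suc))
  where
  δ-suc : ∀ z → δ (suc a) (suc z) * f (suc z) ≡ δ a z * f (suc z)
  δ-suc z with a ≟ᶠ z
  ... | yes refl = refl
  ... | no _     = refl

image? : ∀ {n k} (m : Fin k → Fin n) {P : Fin k → Set} → (∀ j → Dec (P j)) →
  ∀ z → Dec (∃ λ j → m j ≡ z × P j)
image? m P? z = any? λ j → (m j ≟ᶠ z) ×-dec P? j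

sum-over-image : ∀ {n k} {m : Fin k → Fin n} → Injective _≡_ _≡_ m →
  {P : Fin k → Set} (P? : ∀ j → Dec (P j)) (F : Fin n → ℕ) →
  sum (λ z → 𝟙 (does (image? m P? z)) * F z) ≡ sum (λ j → 𝟙 (does (P? j)) * F (m j))
sum-over-image {n} {k} {m} m-injective {P} P? F = begin
  sum (λ z → 𝟙 (does (image? m P? z)) * F z)
    ≡⟨ sum-cong-≗ (λ z → cong (_* F z) (indicator z)) ⟩
  sum (λ z → sum (λ j → p j * δ (m j) z) * F z)
    ≡⟨ sum-cong-≗ (λ z → *-distribʳ-sum (F z) (λ j → p j * δ (m j) z)) ⟩
  sum (λ z → sum λ j → p j * δ (m j) z * F z)
    ≡⟨ ∑-comm {n} {k} _ ⟩
  sum (λ j → sum λ z → p j * δ (m j) z * F z)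
    ≡⟨ sum-cong-≗ (λ j → trans (sum-cong-≗ λ z → *-assoc (p j) (δ (m j) z) (F z))
                                (sym (*-distribˡ-sum (p j) λ z → δ (m j) z * F z))) ⟩
  sum (λ j → p j * sum (λ z → δ (m j) z * F z))
    ≡⟨ sum-cong-≗ (λ j → cong (p j *_) (sum-δ (m j) F)) ⟩
  sum (λ j → p j * F (m j)) ∎
  where
  open ≡-Reasoning
  p : Fin k → ℕ
  p j = 𝟙 (does (P? j))
  δ-image : ∀ i j → δ (m i) (m j) ≡ δ j i
  δ-image i j with m i ≟ᶠ m j | j ≟ᶠ i
  ... | yes _     | yes _    = refl
  ... | no _      | no _     = refl
  ... | yes mi≡mj | no j≢i   = ⊥-elim (j≢i (sym (m-injective mi≡mj)))
  ... | no mi≢mj  | yes refl = ⊥-elim (mi≢mj refl)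
  indicator : ∀ z → 𝟙 (does (image? m P? z)) ≡ sum (λ j → p j * δ (m j) z)
  indicator z with image? m P? z
  ... | no ∉image = sym (sum-zero term≡0)
    where
    term≡0 : ∀ j → p j * δ (m j) z ≡ 0
    term≡0 j with P? j
    ... | no _   = refl
    ... | yes Pj = trans (*-identityˡ _) (𝟙-no (m j ≟ᶠ z) λ mj≡z → ∉image (j , mj≡z , Pj))
  ... | yes (j₀ , refl , Pj₀) = sym (begin
    sum (λ j → p j * δ (m j) (m j₀))
      ≡⟨ sum-cong-≗ (λ j → trans (cong (p j *_) (δ-image j j₀)) (*-comm (p j) _)) ⟩
    sum (λ j → δ j₀ j * p j)
      ≡⟨ sum-δ j₀ p ⟩
    p j₀
      ≡⟨ 𝟙-yes (P? j₀) Pj₀ ⟩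
    1 ∎)

Σ3 : ∀ {n} → (Fin n → Fin n → Fin n → ℕ) → ℕ
Σ3 f = sum λ x → sum λ y → sum λ z → f x y z

Σ3-cong : ∀ {n} {f g : Fin n → Fin n → Fin n → ℕ} → (∀ x y z → f x y z ≡ g x y z) → Σ3 f ≡ Σ3 g
Σ3-cong f≡g = sum-cong-≗ λ x → sum-cong-≗ λ y → sum-cong-≗ λ z → f≡g x y z

Σ3-distrib-+ : ∀ {n} (f g : Fin n → Fin n → Fin n → ℕ) → Σ3 (λ x y z → f x y z + g x y z) ≡ Σ3 f + Σ3 g
Σ3-distrib-+ {n} f g = trans
  (sum-cong-≗ λ x → trans (sum-cong-≗ λ y → ∑-distrib-+ (f x y) (g x y)) (∑-distrib-+ {n} _ _))
  (∑-distrib-+ {n} _ _)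

Σ3-rotate : ∀ {n} (f : Fin n → Fin n → Fin n → ℕ) → Σ3 (λ x y z → f y z x) ≡ Σ3 f
Σ3-rotate {n} f =
  trans (∑-comm {n} {n} (λ x y → sum λ z → f y z x)) (sum-cong-≗ λ y → ∑-comm {n} {n} (λ x z → f y z x))

Cyclic : ∀ {n} → (Fin n → Fin n → Fin n → ℕ) → Set
Cyclic f = ∀ x y z → f x y z ≡ f y z x

cyclicSum : ∀ {n} → (Fin n → Fin n → Fin n → ℕ) → Fin n → Fin n → Fin n → ℕ
cyclicSum c x y z = c x y z + c y z x + c z x y

cyclicSum-cyclic : ∀ {n} (c : Fin n → Fin n → Fin n → ℕ) → Cyclic (cyclicSum c)
cyclicSum-cyclic c x y z = trans (+-assoc (c x y z) _ _) (+-comm (c x y z) _)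

Σ3-cyclicSum : ∀ {n} (c : Fin n → Fin n → Fin n → ℕ) → Σ3 (cyclicSum c) ≡ 3 * Σ3 c
Σ3-cyclicSum {n} c = begin
  Σ3 (cyclicSum c)
    ≡⟨ trans (Σ3-distrib-+ {n} _ _) (cong (_+ Σ3 (λ x y z → c z x y)) (Σ3-distrib-+ {n} _ _)) ⟩
  Σ3 c + Σ3 (λ x y z → c y z x) + Σ3 (λ x y z → c z x y)
    ≡⟨ cong₂ (λ u v → Σ3 c + u + v) (Σ3-rotate c)
             (trans (Σ3-rotate (λ x y z → c y z x)) (Σ3-rotate c)) ⟩
  Σ3 c + Σ3 c + Σ3 c
    ≡⟨ +-assoc (Σ3 c) _ _ ⟩
  Σ3 c + (Σ3 c + Σ3 c)
    ≡⟨ cong (λ u → Σ3 c + (Σ3 c + u)) (+-identityʳ (Σ3 c)) ⟨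
  3 * Σ3 c ∎
  where open ≡-Reasoning

Σ3-cyclicSum-* : ∀ {n} (c f : Fin n → Fin n → Fin n → ℕ) → Cyclic f →
  Σ3 (λ x y z → cyclicSum c x y z * f x y z) ≡ 3 * Σ3 (λ x y z → c x y z * f x y z)
Σ3-cyclicSum-* c f f-cyclic = trans (Σ3-cong distrib) (Σ3-cyclicSum (λ x y z → c x y z * f x y z))
  where
  distrib : ∀ x y z → cyclicSum c x y z * f x y z ≡ cyclicSum (λ x y z → c x y z * f x y z) x y z
  distrib x y z = begin
    (c x y z + c y z x + c z x y) * f x y z
      ≡⟨ *-distribʳ-+ (f x y z) (c x y z + c y z x) (c z x y) ⟩
    (c x y z + c y z x) * f x y z + c z x y * f x y z
      ≡⟨ cong₂ _+_ (*-distribʳ-+ (f x y z) (c x y z) (c y z x))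
                   (cong (c z x y *_) (trans (f-cyclic x y z) (f-cyclic y z x))) ⟩
    c x y z * f x y z + c y z x * f x y z + c z x y * f z x y
      ≡⟨ cong (λ u → c x y z * f x y z + c y z x * u + c z x y * f z x y) (f-cyclic x y z) ⟩
    c x y z * f x y z + c y z x * f y z x + c z x y * f z x y ∎
    where open ≡-Reasoning

-- Pointwise f + w · g = g + w · f for w = cyclicSum c, and summing w · h over all triples
-- gives three times the sum of c · h when h is cyclic.
Σ3-≤-outside-cyclic-support : ∀ {n} (c f g : Fin n → Fin n → Fin n → ℕ) → Cyclic f → Cyclic g →
  (∀ x y z → cyclicSum c x y z ≤ 1) →
  (∀ x y z → cyclicSum c x y z ≡ 0 → f x y z ≡ g x y z) →
  Σ3 (λ x y z → c x y z * f x y z) ≤ Σ3 (λ x y z → c x y z * g x y z) →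
  Σ3 f ≤ Σ3 g
Σ3-≤-outside-cyclic-support {n} c f g f-cyclic g-cyclic c≤1 f≡g cf≤cg =
  +-cancelʳ-≤ (3 * Cg) (Σ3 f) (Σ3 g) (begin
    Σ3 f + 3 * Cg ≡⟨ balanced ⟩
    Σ3 g + 3 * Cf ≤⟨ +-monoʳ-≤ (Σ3 g) (*-monoʳ-≤ 3 cf≤cg) ⟩
    Σ3 g + 3 * Cg ∎)
  where
  open ≤-Reasoning
  w = cyclicSum c
  Cf = Σ3 (λ x y z → c x y z * f x y z)
  Cg = Σ3 (λ x y z → c x y z * g x y z)
  pointwise : ∀ x y z → f x y z + w x y z * g x y z ≡ g x y z + w x y z * f x y z
  pointwise x y z with w x y z | c≤1 x y z | f≡g x y z
  ... | 0 | _         | f≡g₀ = cong (_+ 0) (f≡g₀ refl)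
  ... | 1 | _         | _    = begin-equality
    f x y z + 1 * g x y z ≡⟨ cong (f x y z +_) (*-identityˡ (g x y z)) ⟩
    f x y z + g x y z     ≡⟨ +-comm (f x y z) (g x y z) ⟩
    g x y z + f x y z     ≡⟨ cong (g x y z +_) (*-identityˡ (f x y z)) ⟨
    g x y z + 1 * f x y z ∎
  ... | suc (suc _) | s≤s () | _
  balanced : Σ3 f + 3 * Cg ≡ Σ3 g + 3 * Cf
  balanced = begin-equality
    Σ3 f + 3 * Cg
      ≡⟨ cong (Σ3 f +_) (Σ3-cyclicSum-* c g g-cyclic) ⟨
    Σ3 f + Σ3 (λ x y z → w x y z * g x y z)
      ≡⟨ Σ3-distrib-+ {n} _ _ ⟨
    Σ3 (λ x y z → f x y z + w x y z * g x y z)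
      ≡⟨ Σ3-cong pointwise ⟩
    Σ3 (λ x y z → g x y z + w x y z * f x y z)
      ≡⟨ Σ3-distrib-+ {n} _ _ ⟩
    Σ3 g + Σ3 (λ x y z → w x y z * f x y z)
      ≡⟨ cong (Σ3 g +_) (Σ3-cyclicSum-* c f f-cyclic) ⟩
    Σ3 g + 3 * Cf ∎

rank : ∀ {n} → Ordering n → Fin n → ℕ
rank φ x = toℕ (φ ⟨$⟩ʳ x)

⟦_⊢_≺_⟧ : ∀ {n} → Ordering n → Fin n → Fin n → ℕ
⟦ φ ⊢ x ≺ y ⟧ = 𝟙 (does (pos φ x <? pos φ y))

precedesBoth : ∀ {n} → Ordering n → Fin n → Fin n → Fin n → ℕ
precedesBoth φ p q r = ⟦ φ ⊢ p ≺ q ⟧ * ⟦ φ ⊢ p ≺ r ⟧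

SameOrder : ∀ {n} → Ordering n → Ordering n → Fin n → Fin n → Set
SameOrder φ ψ p q = ⟦ φ ⊢ p ≺ q ⟧ ≡ ⟦ ψ ⊢ p ≺ q ⟧ × ⟦ φ ⊢ q ≺ p ⟧ ≡ ⟦ ψ ⊢ q ≺ p ⟧

module _ {n} (φ : Ordering n) where

  ≺⇒⟦≺⟧≡1 : ∀ {x y} → φ ⊢ x ≺ y → ⟦ φ ⊢ x ≺ y ⟧ ≡ 1
  ≺⇒⟦≺⟧≡1 {x} {y} = 𝟙-yes (pos φ x <? pos φ y)

  ⊀⇒⟦≺⟧≡0 : ∀ {x y} → ¬ φ ⊢ x ≺ y → ⟦ φ ⊢ x ≺ y ⟧ ≡ 0
  ⊀⇒⟦≺⟧≡0 {x} {y} = 𝟙-no (pos φ x <? pos φ y)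

  ≻⇒⟦≺⟧≡0 : ∀ {x y} → φ ⊢ y ≺ x → ⟦ φ ⊢ x ≺ y ⟧ ≡ 0
  ≻⇒⟦≺⟧≡0 y≺x = ⊀⇒⟦≺⟧≡0 (<-asym y≺x)

  ⟦≺⟧-irrefl : ∀ x → ⟦ φ ⊢ x ≺ x ⟧ ≡ 0
  ⟦≺⟧-irrefl x = ⊀⇒⟦≺⟧≡0 (<-irrefl refl)

  ≺-total : ∀ {x y} → x ≢ y → φ ⊢ x ≺ y ⊎ φ ⊢ y ≺ x
  ≺-total {x} {y} x≢y with <-cmp (pos φ x) (pos φ y)
  ... | tri< x≺y _ _ = inj₁ x≺y
  ... | tri> _ _ y≺x = inj₂ y≺x
  ... | tri≈ _ px≡py _ =
    ⊥-elim (x≢y (Injection.injective (↔⇒↣ φ) (toℕ-injective (suc-injective px≡py))))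

  sharedPredecessors : Fin n → Fin n → ℕ
  sharedPredecessors u v = sum λ z → precedesBoth φ z u v

  sharedPredecessors-sym : ∀ u v → sharedPredecessors u v ≡ sharedPredecessors v u
  sharedPredecessors-sym u v = sum-cong-≗ λ z → *-comm ⟦ φ ⊢ z ≺ u ⟧ ⟦ φ ⊢ z ≺ v ⟧

  sharedPredecessors≡rank⊓rank : ∀ u v → sharedPredecessors u v ≡ rank φ u ⊓ rank φ v
  sharedPredecessors≡rank⊓rank u v = begin
    sum (λ z → precedesBoth φ z u v)
      ≡⟨ ∑-permute (λ i → 𝟙 (toℕ i <ᵇ rank φ u) * 𝟙 (toℕ i <ᵇ rank φ v)) φ ⟨
    sum {n} (λ i → 𝟙 (toℕ i <ᵇ rank φ u) * 𝟙 (toℕ i <ᵇ rank φ v))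
      ≡⟨ sum-cong-≗ {n} (λ i → 𝟙<ᵇ-⊓ (toℕ i) (rank φ u) (rank φ v)) ⟩
    sum {n} (λ i → 𝟙 (toℕ i <ᵇ rank φ u ⊓ rank φ v))
      ≡⟨ count-below n _ ⟩
    (rank φ u ⊓ rank φ v) ⊓ n
      ≡⟨ m≤n⇒m⊓n≡m (≤-trans (m⊓n≤m _ _) (<⇒≤ (toℕ<n (φ ⟨$⟩ʳ u)))) ⟩
    rank φ u ⊓ rank φ v ∎
    where
    open ≡-Reasoning
    𝟙<ᵇ-⊓ : ∀ a b c → 𝟙 (a <ᵇ b) * 𝟙 (a <ᵇ c) ≡ 𝟙 (a <ᵇ b ⊓ c)
    𝟙<ᵇ-⊓ a       zero    c       = refl
    𝟙<ᵇ-⊓ a       (suc b) zero    = *-zeroʳ (𝟙 (a <ᵇ suc b))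
    𝟙<ᵇ-⊓ zero    (suc b) (suc c) = refl
    𝟙<ᵇ-⊓ (suc a) (suc b) (suc c) = 𝟙<ᵇ-⊓ a b c
    count-below : ∀ n c → sum {n} (λ i → 𝟙 (toℕ i <ᵇ c)) ≡ c ⊓ n
    count-below zero    c       = sym (⊓-zeroʳ c)
    count-below (suc n) zero    = sum-zero {n} (λ _ → refl)
    count-below (suc n) (suc c) = cong suc (count-below n c)

  precedesBoth-≡1 : ∀ {p q r} → φ ⊢ p ≺ q → φ ⊢ p ≺ r → precedesBoth φ p q r ≡ 1
  precedesBoth-≡1 p≺q p≺r = cong₂ _*_ (≺⇒⟦≺⟧≡1 p≺q) (≺⇒⟦≺⟧≡1 p≺r)

  precedesBoth-≡0ˡ : ∀ {p q r} → φ ⊢ q ≺ p → precedesBoth φ p q r ≡ 0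
  precedesBoth-≡0ˡ {p} {q} {r} q≺p = cong (_* ⟦ φ ⊢ p ≺ r ⟧) (≻⇒⟦≺⟧≡0 q≺p)

  precedesBoth-≡0ʳ : ∀ {p q r} → φ ⊢ r ≺ p → precedesBoth φ p q r ≡ 0
  precedesBoth-≡0ʳ {p} {q} r≺p = trans (cong (⟦ φ ⊢ p ≺ q ⟧ *_) (≻⇒⟦≺⟧≡0 r≺p)) (*-zeroʳ ⟦ φ ⊢ p ≺ q ⟧)

  exactly-one-first : ∀ {x y z} → x ≢ y → y ≢ z → z ≢ x →
    precedesBoth φ z x y + precedesBoth φ x y z + precedesBoth φ y z x ≡ 1
  exactly-one-first {x} {y} {z} x≢y y≢z z≢x = by-cases (≺-total x≢y) (≺-total y≢z) (≺-total z≢x)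
    where
    by-cases : φ ⊢ x ≺ y ⊎ φ ⊢ y ≺ x → φ ⊢ y ≺ z ⊎ φ ⊢ z ≺ y → φ ⊢ z ≺ x ⊎ φ ⊢ x ≺ z →
      precedesBoth φ z x y + precedesBoth φ x y z + precedesBoth φ y z x ≡ 1
    by-cases (inj₁ x≺y) (inj₁ y≺z) (inj₁ z≺x) = ⊥-elim (<-asym (<-trans x≺y y≺z) z≺x)
    by-cases (inj₂ y≺x) (inj₂ z≺y) (inj₂ x≺z) = ⊥-elim (<-asym (<-trans x≺z z≺y) y≺x)
    by-cases (inj₁ x≺y) _          (inj₂ x≺z) =
      cong₂ _+_ (cong₂ _+_ (precedesBoth-≡0ˡ x≺z) (precedesBoth-≡1 x≺y x≺z)) (precedesBoth-≡0ʳ x≺y)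
    by-cases (inj₂ y≺x) (inj₁ y≺z) _          =
      cong₂ _+_ (cong₂ _+_ (precedesBoth-≡0ʳ y≺z) (precedesBoth-≡0ˡ y≺x)) (precedesBoth-≡1 y≺z y≺x)
    by-cases _          (inj₂ z≺y) (inj₁ z≺x) =
      cong₂ _+_ (cong₂ _+_ (precedesBoth-≡1 z≺x z≺y) (precedesBoth-≡0ʳ z≺x)) (precedesBoth-≡0ˡ z≺y)

⟦≺⟧-via : ∀ {n} (φ ψ : Ordering n) {x y} {P : Set} → φ ⊢ x ≺ y ⇔ P → ψ ⊢ x ≺ y ⇔ P →
  ⟦ φ ⊢ x ≺ y ⟧ ≡ ⟦ ψ ⊢ x ≺ y ⟧
⟦≺⟧-via φ ψ {x} {y} φ⇔P ψ⇔P with pos φ x <? pos φ y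
... | yes x≺y = trans (≺⇒⟦≺⟧≡1 φ x≺y) (sym (≺⇒⟦≺⟧≡1 ψ (from ψ⇔P (to φ⇔P x≺y))))
  where open Equivalence
... | no  x⊀y = trans (⊀⇒⟦≺⟧≡0 φ x⊀y) (sym (⊀⇒⟦≺⟧≡0 ψ (x⊀y ∘ from φ⇔P ∘ to ψ⇔P)))
  where open Equivalence

-- The cost as a sum over triples

module _ {n} (G : SimpleGraph n) where

  edge : Fin n → Fin n → ℕ
  edge u v = 𝟙 (adj G u v)

  orientedEdge : Fin n → Fin n → ℕ
  orientedEdge u v = 𝟙 (adj G u v ∧ (toℕ u <ᵇ toℕ v))

  edge-sym : ∀ u v → edge u v ≡ edge v u
  edge-sym u v = cong 𝟙 (SimpleGraph.sym G u v)

  edge-irrefl : ∀ u → edge u u ≡ 0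
  edge-irrefl u = cong 𝟙 (SimpleGraph.irrefl G u)

  edge-orientations : ∀ u v → edge u v ≡ orientedEdge u v + orientedEdge v u
  edge-orientations u v rewrite SimpleGraph.sym G v u with adj G u v in uv
  ... | false = refl
  ... | true with <-cmp (toℕ u) (toℕ v)
  ...   | tri< u<v _ v≮u = sym (cong₂ _+_ (𝟙-yes (toℕ u <? toℕ v) u<v) (𝟙-no (toℕ v <? toℕ u) v≮u))
  ...   | tri> u≮v _ v<u = sym (cong₂ _+_ (𝟙-no (toℕ u <? toℕ v) u≮v) (𝟙-yes (toℕ v <? toℕ u) v<u))
  ...   | tri≈ _ u≡v _   = contradiction
          (trans (sym uv) (trans (cong (adj G u) (sym (toℕ-injective u≡v))) (SimpleGraph.irrefl G u))) λ ()

  edgeAfter : Ordering n → Fin n → Fin n → Fin n → ℕ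
  edgeAfter φ x y z = edge x y * precedesBoth φ z x y

  -- On distinct x, y, z: the adjacency of the two vertices placed after the first one.
  tripleWeight : Ordering n → Fin n → Fin n → Fin n → ℕ
  tripleWeight φ = cyclicSum (edgeAfter φ)

  cost-as-sum : ∀ φ → cost G φ ≡ sum λ u → sum λ v → orientedEdge u v * suc (sharedPredecessors φ u v)
  cost-as-sum φ = begin
    cost G φ
      ≡⟨ listSum-allFin (λ u → listSum (map (entry u) (allFin n))) ⟩
    sum (λ u → listSum (map (entry u) (allFin n)))
      ≡⟨ sum-cong-≗ (λ u → trans (listSum-allFin (entry u)) (sum-cong-≗ (entry≡ u))) ⟩
    sum (λ u → sum λ v → orientedEdge u v * suc (sharedPredecessors φ u v)) ∎
    where
    open ≡-Reasoning
    entry : Fin n → Fin n → ℕ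
    entry u v = if adj G u v ∧ (toℕ u <ᵇ toℕ v) then pos φ u ⊓ pos φ v else 0
    entry≡ : ∀ u v → entry u v ≡ orientedEdge u v * suc (sharedPredecessors φ u v)
    entry≡ u v with adj G u v ∧ (toℕ u <ᵇ toℕ v)
    ... | false = refl
    ... | true  = cong suc (trans (sym (sharedPredecessors≡rank⊓rank φ u v)) (sym (+-identityʳ _)))

  cost+cost : ∀ φ → cost G φ + cost G φ ≡ sum λ u → sum λ v → edge u v * suc (sharedPredecessors φ u v)
  cost+cost φ = begin
    cost G φ + cost G φ
      ≡⟨ cong₂ _+_ (cost-as-sum φ) (trans (cost-as-sum φ) (∑-comm {n} {n} _)) ⟩
    sum (λ u → sum λ v → orientedEdge u v * S u v) + sum (λ u → sum λ v → orientedEdge v u * S v u)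
      ≡⟨ ∑-distrib-+ {n} _ _ ⟨
    sum (λ u → sum (λ v → orientedEdge u v * S u v) + sum λ v → orientedEdge v u * S v u)
      ≡⟨ sum-cong-≗ (λ u → trans (sym (∑-distrib-+ {n} _ _)) (sum-cong-≗ (λ v → merge u v))) ⟩
    sum (λ u → sum λ v → edge u v * S u v) ∎
    where
    open ≡-Reasoning
    S : Fin n → Fin n → ℕ
    S u v = suc (sharedPredecessors φ u v)
    merge : ∀ u v → orientedEdge u v * S u v + orientedEdge v u * S v u ≡ edge u v * S u v
    merge u v = begin
      orientedEdge u v * S u v + orientedEdge v u * S v u
        ≡⟨ cong (λ s → orientedEdge u v * S u v + orientedEdge v u * suc s) (sharedPredecessors-sym φ v u) ⟩
      orientedEdge u v * S u v + orientedEdge v u * S u v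
        ≡⟨ *-distribʳ-+ (S u v) (orientedEdge u v) _ ⟨
      (orientedEdge u v + orientedEdge v u) * S u v
        ≡⟨ cong (_* S u v) (edge-orientations u v) ⟨
      edge u v * S u v ∎

  degreeSum : ℕ
  degreeSum = sum λ u → sum λ v → edge u v

  cost-as-triple-sum : ∀ φ → 6 * cost G φ ≡ 3 * degreeSum + Σ3 (tripleWeight φ)
  cost-as-triple-sum φ = begin
    6 * cost G φ
      ≡⟨ *-assoc 3 2 (cost G φ) ⟩
    3 * (cost G φ + (cost G φ + 0))
      ≡⟨ cong (λ c → 3 * (cost G φ + c)) (+-identityʳ (cost G φ)) ⟩
    3 * (cost G φ + cost G φ)
      ≡⟨ cong (3 *_) (cost+cost φ) ⟩
    3 * (sum λ u → sum λ v → edge u v * suc (sharedPredecessors φ u v))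
      ≡⟨ cong (3 *_) (trans (sum-cong-≗ λ u → trans (sum-cong-≗ (split u)) (∑-distrib-+ {n} _ _))
                            (∑-distrib-+ {n} _ _)) ⟩
    3 * (degreeSum + Σ3 (edgeAfter φ))
      ≡⟨ *-distribˡ-+ 3 degreeSum _ ⟩
    3 * degreeSum + 3 * Σ3 (edgeAfter φ)
      ≡⟨ cong (3 * degreeSum +_) (Σ3-cyclicSum (edgeAfter φ)) ⟨
    3 * degreeSum + Σ3 (tripleWeight φ) ∎
    where
    open ≡-Reasoning
    split : ∀ u v → edge u v * suc (sharedPredecessors φ u v) ≡ edge u v + sum λ z → edgeAfter φ u v z
    split u v = trans (*-suc (edge u v) _)
                      (cong (edge u v +_) (*-distribˡ-sum (edge u v) (λ z → precedesBoth φ z u v)))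

  cost-≤-by-tripleWeight : ∀ φ ψ → Σ3 (tripleWeight φ) ≤ Σ3 (tripleWeight ψ) → cost G φ ≤ cost G ψ
  cost-≤-by-tripleWeight φ ψ Σφ≤Σψ = *-cancelˡ-≤ 6 (begin
    6 * cost G φ                         ≡⟨ cost-as-triple-sum φ ⟩
    3 * degreeSum + Σ3 (tripleWeight φ) ≤⟨ +-monoʳ-≤ (3 * degreeSum) Σφ≤Σψ ⟩
    3 * degreeSum + Σ3 (tripleWeight ψ) ≡⟨ cost-as-triple-sum ψ ⟨
    6 * cost G ψ                         ∎)
    where open ≤-Reasoning

  tripleWeight-cyclic : ∀ φ → Cyclic (tripleWeight φ)
  tripleWeight-cyclic φ = cyclicSum-cyclic (edgeAfter φ)

  tripleWeight-≡ : ∀ φ {x y z a b c} →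
    precedesBoth φ z x y ≡ a → precedesBoth φ x y z ≡ b → precedesBoth φ y z x ≡ c →
    tripleWeight φ x y z ≡ edge x y * a + edge y z * b + edge z x * c
  tripleWeight-≡ φ {x} {y} {z} ≡a ≡b ≡c =
    cong₂ _+_ (cong₂ _+_ (cong (edge x y *_) ≡a) (cong (edge y z *_) ≡b)) (cong (edge z x *_) ≡c)

  tripleWeight-first : ∀ φ {x y z} → φ ⊢ z ≺ x → φ ⊢ z ≺ y → tripleWeight φ x y z ≡ edge x y
  tripleWeight-first φ {x} {y} {z} z≺x z≺y = begin
    tripleWeight φ x y z
      ≡⟨ tripleWeight-≡ φ (precedesBoth-≡1 φ z≺x z≺y) (precedesBoth-≡0ʳ φ z≺x) (precedesBoth-≡0ˡ φ z≺y) ⟩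
    edge x y * 1 + edge y z * 0 + edge z x * 0
      ≡⟨ cong₂ _+_ (cong₂ _+_ (*-identityʳ (edge x y)) (*-zeroʳ (edge y z))) (*-zeroʳ (edge z x)) ⟩
    edge x y + 0 + 0
      ≡⟨ trans (+-identityʳ _) (+-identityʳ _) ⟩
    edge x y ∎
    where open ≡-Reasoning

  tripleWeight-last : ∀ φ {x y z} → φ ⊢ x ≺ z → φ ⊢ y ≺ z →
    tripleWeight φ x y z ≡ edge y z * ⟦ φ ⊢ x ≺ y ⟧ + edge x z * ⟦ φ ⊢ y ≺ x ⟧
  tripleWeight-last φ {x} {y} {z} x≺z y≺z = begin
    tripleWeight φ x y z
      ≡⟨ tripleWeight-≡ φ (precedesBoth-≡0ˡ φ x≺z) refl refl ⟩
    edge x y * 0 + edge y z * (⟦ φ ⊢ x ≺ y ⟧ * ⟦ φ ⊢ x ≺ z ⟧) + edge z x * (⟦ φ ⊢ y ≺ z ⟧ * ⟦ φ ⊢ y ≺ x ⟧)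
      ≡⟨ cong₂ (λ s t → edge x y * 0 + edge y z * s + edge z x * t)
           (trans (cong (⟦ φ ⊢ x ≺ y ⟧ *_) (≺⇒⟦≺⟧≡1 φ x≺z)) (*-identityʳ _))
           (trans (cong (_* ⟦ φ ⊢ y ≺ x ⟧) (≺⇒⟦≺⟧≡1 φ y≺z)) (*-identityˡ _)) ⟩
    edge x y * 0 + edge y z * ⟦ φ ⊢ x ≺ y ⟧ + edge z x * ⟦ φ ⊢ y ≺ x ⟧
      ≡⟨ cong₂ (λ s e → s + edge y z * ⟦ φ ⊢ x ≺ y ⟧ + e * ⟦ φ ⊢ y ≺ x ⟧)
               (*-zeroʳ (edge x y)) (edge-sym z x) ⟩
    edge y z * ⟦ φ ⊢ x ≺ y ⟧ + edge x z * ⟦ φ ⊢ y ≺ x ⟧ ∎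
    where open ≡-Reasoning

  tripleWeight-diagonal : ∀ φ x z → tripleWeight φ x x z ≡ 0
  tripleWeight-diagonal φ x z = begin
    tripleWeight φ x x z
      ≡⟨ tripleWeight-≡ φ refl (cong (_* ⟦ φ ⊢ x ≺ z ⟧) (⟦≺⟧-irrefl φ x))
                               (cong (⟦ φ ⊢ x ≺ z ⟧ *_) (⟦≺⟧-irrefl φ x)) ⟩
    edge x x * precedesBoth φ z x x + edge x z * 0 + edge z x * (⟦ φ ⊢ x ≺ z ⟧ * 0)
      ≡⟨ cong₂ (λ e t → e * precedesBoth φ z x x + edge x z * 0 + edge z x * t)
               (edge-irrefl x) (*-zeroʳ ⟦ φ ⊢ x ≺ z ⟧) ⟩
    edge x z * 0 + edge z x * 0
      ≡⟨ cong₂ _+_ (*-zeroʳ (edge x z)) (*-zeroʳ (edge z x)) ⟩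
    0 ∎
    where open ≡-Reasoning

  tripleWeight-degenerate : ∀ φ {x y z} → x ≡ y ⊎ y ≡ z ⊎ z ≡ x → tripleWeight φ x y z ≡ 0
  tripleWeight-degenerate φ {x} {z = z} (inj₁ refl) = tripleWeight-diagonal φ x z
  tripleWeight-degenerate φ {x} {y} (inj₂ (inj₁ refl)) =
    trans (tripleWeight-cyclic φ x y y) (tripleWeight-diagonal φ y x)
  tripleWeight-degenerate φ {x} {y} (inj₂ (inj₂ refl)) =
    trans (tripleWeight-cyclic φ x y x) (trans (tripleWeight-cyclic φ y x x) (tripleWeight-diagonal φ x y))

  tripleWeight-triangle : ∀ φ {x y z} → adj G x y ≡ true → adj G y z ≡ true → adj G z x ≡ true →
    x ≢ y → y ≢ z → z ≢ x → tripleWeight φ x y z ≡ 1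
  tripleWeight-triangle φ {x} {y} {z} xy yz zx x≢y y≢z z≢x = begin
    tripleWeight φ x y z
      ≡⟨ tripleWeight-≡ φ refl refl refl ⟩
    edge x y * precedesBoth φ z x y + edge y z * precedesBoth φ x y z + edge z x * precedesBoth φ y z x
      ≡⟨ cong₂ _+_ (cong₂ _+_ (cong (λ b → 𝟙 b * precedesBoth φ z x y) xy)
                              (cong (λ b → 𝟙 b * precedesBoth φ x y z) yz))
                   (cong (λ b → 𝟙 b * precedesBoth φ y z x) zx) ⟩
    1 * precedesBoth φ z x y + 1 * precedesBoth φ x y z + 1 * precedesBoth φ y z x
      ≡⟨ cong₂ _+_ (cong₂ _+_ (*-identityˡ (precedesBoth φ z x y)) (*-identityˡ (precedesBoth φ x y z)))
                   (*-identityˡ (precedesBoth φ y z x)) ⟩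
    precedesBoth φ z x y + precedesBoth φ x y z + precedesBoth φ y z x
      ≡⟨ exactly-one-first φ x≢y y≢z z≢x ⟩
    1 ∎
    where open ≡-Reasoning

  tripleWeight-cong : ∀ φ ψ {x y z} → SameOrder φ ψ x y → SameOrder φ ψ y z → SameOrder φ ψ z x →
    tripleWeight φ x y z ≡ tripleWeight ψ x y z
  tripleWeight-cong φ ψ (xy , yx) (yz , zy) (zx , xz) =
    tripleWeight-≡ φ (cong₂ _*_ zx zy) (cong₂ _*_ xy xz) (cong₂ _*_ yz yx)

  tripleWeight-on-clique : ∀ φ ψ {x y z} →
    (x ≢ y → adj G x y ≡ true) → (y ≢ z → adj G y z ≡ true) → (z ≢ x → adj G z x ≡ true) →
    tripleWeight φ x y z ≡ tripleWeight ψ x y z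
  tripleWeight-on-clique φ ψ {x} {y} {z} xy yz zx = by-cases (x ≟ᶠ y) (y ≟ᶠ z) (z ≟ᶠ x)
    where
    both-zero : x ≡ y ⊎ y ≡ z ⊎ z ≡ x → tripleWeight φ x y z ≡ tripleWeight ψ x y z
    both-zero eq = trans (tripleWeight-degenerate φ eq) (sym (tripleWeight-degenerate ψ eq))
    by-cases : Dec (x ≡ y) → Dec (y ≡ z) → Dec (z ≡ x) → tripleWeight φ x y z ≡ tripleWeight ψ x y z
    by-cases (yes x≡y) _         _         = both-zero (inj₁ x≡y)
    by-cases (no _)    (yes y≡z) _         = both-zero (inj₂ (inj₁ y≡z))
    by-cases (no _)    (no _)    (yes z≡x) = both-zero (inj₂ (inj₂ z≡x))
    by-cases (no x≢y)  (no y≢z)  (no z≢x)  =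
      trans (tripleWeight-triangle φ (xy x≢y) (yz y≢z) (zx z≢x) x≢y y≢z z≢x)
            (sym (tripleWeight-triangle ψ (xy x≢y) (yz y≢z) (zx z≢x) x≢y y≢z z≢x))

-- Blocks of an ordering around the modulator

first : ∀ {k} {P : Fin k → Set} → (∀ i → Dec (P i)) → Fin (suc k)
first {zero}  P? = zero
first {suc k} P? with P? zero
... | yes _ = zero
... | no  _ = suc (first (P? ∘ suc))

first-minimal : ∀ {k} {P : Fin k → Set} (P? : ∀ i → Dec (P i)) i → toℕ i < toℕ (first P?) → ¬ P i
first-minimal {suc k} P? i       i<first         with P? zero
first-minimal {suc k} P? zero    ()              | yes _
first-minimal {suc k} P? (suc i) ()              | yes _
first-minimal {suc k} P? zero    _               | no ¬P₀ = ¬P₀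
first-minimal {suc k} P? (suc i) (s≤s i<first)   | no _   = first-minimal (P? ∘ suc) i i<first

first-satisfies : ∀ {k} {P : Fin k → Set} (P? : ∀ i → Dec (P i)) i → toℕ i ≡ toℕ (first P?) → P i
first-satisfies {suc k} P? i       i≡first with P? zero
first-satisfies {suc k} P? zero    _       | yes P₀ = P₀
first-satisfies {suc k} P? (suc i) ()      | yes _
first-satisfies {suc k} P? zero    ()      | no _
first-satisfies {suc k} P? (suc i) i≡first | no _   = first-satisfies (P? ∘ suc) i (suc-injective i≡first)

module Blocks {n k} (m : Fin k → Fin n) (σM : Permutation′ k) where

  place : Fin k → ℕ
  place j = toℕ (σM ⟨$⟩ʳ j)

  vertexAt : ∀ {p} → p < k → ∃ λ j → place j ≡ p
  vertexAt p<k = σM ⟨$⟩ˡ fromℕ< p<k , trans (cong toℕ (inverseʳ σM)) (toℕ-fromℕ< p<k)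

  place-injective : ∀ {j j'} → place j ≡ place j' → j ≡ j'
  place-injective = Injection.injective (↔⇒↣ σM) ∘ toℕ-injective

  InM? : ∀ z → Dec (InM m z)
  InM? z = any? λ j → m j ≟ᶠ z

  blockOf : Ordering n → Fin n → Fin (suc k)
  blockOf τ u = first λ i → pos τ u <? pos τ (m (σM ⟨$⟩ˡ i))

  blockOf-InBlock : ∀ τ {u} → InQ m u → InBlock τ m σM u (blockOf τ u)
  blockOf-InBlock τ {u} u∉M = m≺u , u≺m
    where
    u≺m : ∀ j → place j ≡ toℕ (blockOf τ u) → τ ⊢ u ≺ m j
    u≺m j eq = subst (λ j' → τ ⊢ u ≺ m j') (inverseˡ σM) (first-satisfies _ (σM ⟨$⟩ʳ j) eq)
    m≺u : ∀ j → suc (place j) ≡ toℕ (blockOf τ u) → τ ⊢ m j ≺ u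
    m≺u j eq with ≺-total τ {m j} {u} (λ mj≡u → u∉M (j , mj≡u))
    ... | inj₁ mj≺u = mj≺u
    ... | inj₂ u≺mj = contradiction (subst (λ j' → τ ⊢ u ≺ m j') (sym (inverseˡ σM)) u≺mj)
                                    (first-minimal _ (σM ⟨$⟩ʳ j) (≤-reflexive eq))

  module _ (τ : Ordering n) (restricts : RestrictsTo τ m σM) where

    m≺m⇔ : ∀ j j' → τ ⊢ m j ≺ m j' ⇔ place j < place j'
    m≺m⇔ j j' = mk⇔ (proj₁ (restricts j j')) (proj₂ (restricts j j'))

    ≡⊎m≺m : ∀ {j j'} → place j ≤ place j' → j ≡ j' ⊎ τ ⊢ m j ≺ m j'
    ≡⊎m≺m j≤j' with m≤n⇒m<n∨m≡n j≤j'
    ... | inj₁ j<j' = inj₂ (Equivalence.from (m≺m⇔ _ _) j<j')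
    ... | inj₂ j≡j' = inj₁ (place-injective j≡j')

    m≺block : ∀ {u β} → InBlock τ m σM u β → ∀ j → place j < toℕ β → τ ⊢ m j ≺ u
    m≺block {u} {β} (m≺u , _) j j<β with toℕ β | toℕ<n β
    ... | suc p | p<k with vertexAt (≤-pred p<k)
    ...   | j' , j'≡p with ≡⊎m≺m {j} {j'} (≤-trans (≤-pred j<β) (≤-reflexive (sym j'≡p)))
    ...     | inj₁ refl  = m≺u j (cong suc j'≡p)
    ...     | inj₂ j≺j'  = <-trans j≺j' (m≺u j' (cong suc j'≡p))

    block≺m : ∀ {u β} → InBlock τ m σM u β → ∀ j → toℕ β ≤ place j → τ ⊢ u ≺ m j
    block≺m {u} {β} (_ , u≺m) j β≤j with vertexAt (≤-<-trans β≤j (toℕ<n (σM ⟨$⟩ʳ j)))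
    ... | j' , j'≡β with ≡⊎m≺m {j'} {j} (≤-trans (≤-reflexive j'≡β) β≤j)
    ...   | inj₁ refl = u≺m j j'≡β
    ...   | inj₂ j'≺j = <-trans (u≺m j' j'≡β) j'≺j

  Respects : (Fin n → Fin (suc k)) → Ordering n → Set
  Respects blk τ = RestrictsTo τ m σM × (∀ u → InQ m u → InBlock τ m σM u (blk u))

  SameBlock : (Fin n → Fin (suc k)) → Fin n → Fin n → Set
  SameBlock blk u w = InQ m u × InQ m w × u ≢ w × blk u ≡ blk w

  SameBlock? : ∀ blk u w → Dec (SameBlock blk u w)
  SameBlock? blk u w = ¬? (InM? u) ×-dec ¬? (InM? w) ×-dec ¬? (u ≟ᶠ w) ×-dec (blk u ≟ᶠ blk w)

  SameBlock-sym : ∀ {blk u w} → SameBlock blk u w → SameBlock blk w u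
  SameBlock-sym (u∉M , w∉M , u≢w , same) = w∉M , u∉M , u≢w ∘ sym , sym same

  module _ {blk : Fin n → Fin (suc k)} (τ : Ordering n) (respects : Respects blk τ) where

    m≺q⇔ : ∀ j {u} → InQ m u → τ ⊢ m j ≺ u ⇔ place j < toℕ (blk u)
    m≺q⇔ j {u} u∉M = mk⇔ to (m≺block τ (proj₁ respects) (proj₂ respects u u∉M) j)
      where
      to : τ ⊢ m j ≺ u → place j < toℕ (blk u)
      to mj≺u with place j <? toℕ (blk u)
      ... | yes j<β = j<β
      ... | no  j≮β =
        ⊥-elim (<-asym mj≺u (block≺m τ (proj₁ respects) (proj₂ respects u u∉M) j (≮⇒≥ j≮β)))

    q≺m⇔ : ∀ j {u} → InQ m u → τ ⊢ u ≺ m j ⇔ toℕ (blk u) ≤ place j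
    q≺m⇔ j {u} u∉M = mk⇔ to (block≺m τ (proj₁ respects) (proj₂ respects u u∉M) j)
      where
      to : τ ⊢ u ≺ m j → toℕ (blk u) ≤ place j
      to u≺mj with toℕ (blk u) ≤? place j
      ... | yes β≤j = β≤j
      ... | no  β≰j =
        ⊥-elim (<-asym u≺mj (m≺block τ (proj₁ respects) (proj₂ respects u u∉M) j (≰⇒> β≰j)))

    q≺q-by-block : ∀ {u w} → InQ m u → InQ m w → toℕ (blk u) < toℕ (blk w) → τ ⊢ u ≺ w
    q≺q-by-block {u} {w} u∉M w∉M βu<βw with vertexAt (<-≤-trans βu<βw (≤-pred (toℕ<n (blk w))))
    ... | j , j≡βu = <-trans (proj₂ (proj₂ respects u u∉M) j j≡βu)
                             (m≺block τ (proj₁ respects) (proj₂ respects w w∉M) j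
                                      (≤-trans (s≤s (≤-reflexive j≡βu)) βu<βw))

    q≺q⇔ : ∀ {u w} → InQ m u → InQ m w → blk u ≢ blk w → τ ⊢ u ≺ w ⇔ toℕ (blk u) < toℕ (blk w)
    q≺q⇔ {u} {w} u∉M w∉M βu≢βw = mk⇔ to (q≺q-by-block u∉M w∉M)
      where
      to : τ ⊢ u ≺ w → toℕ (blk u) < toℕ (blk w)
      to u≺w with <-cmp (toℕ (blk u)) (toℕ (blk w))
      ... | tri< βu<βw _ _ = βu<βw
      ... | tri≈ _ βu≡βw _ = ⊥-elim (βu≢βw (toℕ-injective βu≡βw))
      ... | tri> _ _ βw<βu = ⊥-elim (<-asym u≺w (q≺q-by-block w∉M u∉M βw<βu))

  module _ {blk : Fin n → Fin (suc k)} (τ₁ τ₂ : Ordering n)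
           (r₁ : Respects blk τ₁) (r₂ : Respects blk τ₂) where

    ⟦≺⟧-outside-blocks : ∀ {a b} → ¬ SameBlock blk a b → ⟦ τ₁ ⊢ a ≺ b ⟧ ≡ ⟦ τ₂ ⊢ a ≺ b ⟧
    ⟦≺⟧-outside-blocks {a} {b} ¬same with a ≟ᶠ b
    ... | yes refl = trans (⟦≺⟧-irrefl τ₁ a) (sym (⟦≺⟧-irrefl τ₂ a))
    ... | no a≢b with InM? a | InM? b
    ...   | yes (j , refl) | yes (j' , refl) =
            ⟦≺⟧-via τ₁ τ₂ (m≺m⇔ τ₁ (proj₁ r₁) j j') (m≺m⇔ τ₂ (proj₁ r₂) j j')
    ...   | yes (j , refl) | no b∉M = ⟦≺⟧-via τ₁ τ₂ (m≺q⇔ τ₁ r₁ j b∉M) (m≺q⇔ τ₂ r₂ j b∉M)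
    ...   | no a∉M | yes (j , refl) = ⟦≺⟧-via τ₁ τ₂ (q≺m⇔ τ₁ r₁ j a∉M) (q≺m⇔ τ₂ r₂ j a∉M)
    ...   | no a∉M         | no b∉M with blk a ≟ᶠ blk b
    ...     | yes βa≡βb = ⊥-elim (¬same (a∉M , b∉M , a≢b , βa≡βb))
    ...     | no  βa≢βb =
              ⟦≺⟧-via τ₁ τ₂ (q≺q⇔ τ₁ r₁ a∉M b∉M βa≢βb) (q≺q⇔ τ₂ r₂ a∉M b∉M βa≢βb)

    sameOrder-outside-blocks : ∀ {a b} → ¬ SameBlock blk a b → SameOrder τ₁ τ₂ a b
    sameOrder-outside-blocks ¬same = ⟦≺⟧-outside-blocks ¬same , ⟦≺⟧-outside-blocks (¬same ∘ SameBlock-sym)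

-- The exchange argument

module Exchange {n k ℓ : ℕ} (G : SimpleGraph n) (m : Fin k → Fin n) (cls : Fin n → Fin ℓ)
    (m-injective : Injective _≡_ _≡_ m)
    (clique : IsCliqueModulator G m)
    (classes : IsClassLabelling G m cls)
    (σM : Permutation′ k)
    (g : Fin (suc k) → Permutation′ ℓ)
    (g-sorted : ∀ b j j' u w → InQ m u → InQ m w
       → cls u ≡ g b ⟨$⟩ʳ j → cls w ≡ g b ⟨$⟩ʳ j' → toℕ j < toℕ j'
       → rm G m σM u b ≥ rm G m σM w b)
    (σ : Ordering n) (σ-restricts : RestrictsTo σ m σM)
    (σ̂ : Ordering n) (σ̂-restricts : RestrictsTo σ̂ m σM)
    (same-blocks : ∀ u b → InQ m u → (InBlock σ m σM u b → InBlock σ̂ m σM u b)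
                                     × (InBlock σ̂ m σM u b → InBlock σ m σM u b))
    (σ̂-sorted : ∀ b u w j j' → InQ m u → InQ m w
       → InBlock σ m σM u b → InBlock σ m σM w b
       → cls u ≡ g b ⟨$⟩ʳ j → cls w ≡ g b ⟨$⟩ʳ j' → toℕ j < toℕ j'
       → σ̂ ⊢ u ≺ w) where

  open Blocks m σM

  blk : Fin n → Fin (suc k)
  blk = blockOf σ

  σ-respects : Respects blk σ
  σ-respects = σ-restricts , λ u u∉M → blockOf-InBlock σ u∉M

  σ̂-respects : Respects blk σ̂
  σ̂-respects = σ̂-restricts , λ u u∉M → proj₁ (same-blocks u (blk u) u∉M) (blockOf-InBlock σ u∉M)

  rm-as-sum-over-M : ∀ w β → rm G m σM w β ≡ sum λ j → 𝟙 (does (toℕ β ≤? place j)) * edge G w (m j)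
  rm-as-sum-over-M w β =
    trans (listSum-allFin (λ j → if adj G w (m j) ∧ does (toℕ β ≤? place j) then 1 else 0))
          (sum-cong-≗ λ j → 𝟙-∧ (adj G w (m j)) (does (toℕ β ≤? place j)))

  rm-cong : ∀ {u w} → SameModNbhd G m u w → ∀ β → rm G m σM u β ≡ rm G m σM w β
  rm-cong same β = trans (rm-as-sum-over-M _ β)
    (trans (sum-cong-≗ λ j → cong (λ b → 𝟙 (does (toℕ β ≤? place j)) * 𝟙 b) (same j))
           (sym (rm-as-sum-over-M _ β)))

  AfterBlock : Fin (suc k) → Fin n → Set
  AfterBlock β z = ∃ λ j → m j ≡ z × toℕ β ≤ place j

  afterBlock? : ∀ β z → Dec (AfterBlock β z)
  afterBlock? β = image? m (λ j → toℕ β ≤? place j)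

  rm-as-sum : ∀ w β → sum (λ z → 𝟙 (does (afterBlock? β z)) * edge G w z) ≡ rm G m σM w β
  rm-as-sum w β =
    trans (sum-over-image m-injective (λ j → toℕ β ≤? place j) (edge G w)) (sym (rm-as-sum-over-M w β))

  -- Up to rotation, the only triples whose weight σ̂ may change.
  Critical : Fin n → Fin n → Fin n → Set
  Critical x y z = SameBlock blk x y × AfterBlock (blk x) z

  critical? : ∀ x y z → Dec (Critical x y z)
  critical? x y z = SameBlock? blk x y ×-dec afterBlock? (blk x) z

  critical : Fin n → Fin n → Fin n → ℕ
  critical x y z = 𝟙 (does (critical? x y z))

  critical-not-rotated : ∀ {x y z} → Critical x y z → ¬ Critical y z x
  critical-not-rotated (_ , j , mj≡z , _) ((_ , z∉M , _) , _) = z∉M (j , mj≡z)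

  cyclicSum-critical≤1 : ∀ x y z → cyclicSum critical x y z ≤ 1
  cyclicSum-critical≤1 x y z = by-cases (critical? x y z) (critical? y z x) (critical? z x y)
    where
    by-cases : (c₁ : Dec (Critical x y z)) (c₂ : Dec (Critical y z x)) (c₃ : Dec (Critical z x y)) →
      𝟙 (does c₁) + 𝟙 (does c₂) + 𝟙 (does c₃) ≤ 1
    by-cases (yes c₁) (yes c₂) _        = ⊥-elim (critical-not-rotated c₁ c₂)
    by-cases _        (yes c₂) (yes c₃) = ⊥-elim (critical-not-rotated c₂ c₃)
    by-cases (yes c₁) _        (yes c₃) = ⊥-elim (critical-not-rotated c₃ c₁)
    by-cases (yes _)  (no _)   (no _)   = ≤-refl
    by-cases (no _)   (yes _)  (no _)   = ≤-refl
    by-cases (no _)   (no _)   (yes _)  = ≤-refl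
    by-cases (no _)   (no _)   (no _)   = z≤n

  tripleWeight-unchanged-in-block : ∀ {x y z} → SameBlock blk x y → ¬ AfterBlock (blk x) z →
    tripleWeight G σ̂ x y z ≡ tripleWeight G σ x y z
  tripleWeight-unchanged-in-block {x} {y} {z} (x∉M , y∉M , _ , βx≡βy) ¬after with InM? z
  ... | no z∉M =
    tripleWeight-on-clique G σ̂ σ (clique x y x∉M y∉M) (clique y z y∉M z∉M) (clique z x z∉M x∉M)
  ... | yes (j , refl) = trans (first-in σ̂ σ̂-respects) (sym (first-in σ σ-respects))
    where
    j<βx : place j < toℕ (blk x)
    j<βx = ≰⇒> λ βx≤j → ¬after (j , refl , βx≤j)
    first-in : ∀ τ → Respects blk τ → tripleWeight G τ x y (m j) ≡ edge G x y
    first-in τ (restricts , inBlock) = tripleWeight-first G τ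
      (m≺block τ restricts (inBlock x x∉M) j j<βx)
      (m≺block τ restricts (inBlock y y∉M) j (subst (λ β → place j < toℕ β) βx≡βy j<βx))

  tripleWeight-unchanged : ∀ x y z → cyclicSum critical x y z ≡ 0 →
    tripleWeight G σ̂ x y z ≡ tripleWeight G σ x y z
  tripleWeight-unchanged x y z = by-cases (critical? x y z) (critical? y z x) (critical? z x y)
    where
    rotated : ∀ {x y z} → tripleWeight G σ̂ y z x ≡ tripleWeight G σ y z x →
      tripleWeight G σ̂ x y z ≡ tripleWeight G σ x y z
    rotated {x} {y} {z} eq =
      trans (tripleWeight-cyclic G σ̂ x y z) (trans eq (sym (tripleWeight-cyclic G σ x y z)))
    unchanged : ¬ Critical x y z → ¬ Critical y z x → ¬ Critical z x y →
      Dec (SameBlock blk x y) → Dec (SameBlock blk y z) → Dec (SameBlock blk z x) →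
      tripleWeight G σ̂ x y z ≡ tripleWeight G σ x y z
    unchanged ¬c₁ _   _   (yes xy) _        _        = tripleWeight-unchanged-in-block xy (¬c₁ ∘ (xy ,_))
    unchanged _   ¬c₂ _   _        (yes yz) _        =
      rotated (tripleWeight-unchanged-in-block yz (¬c₂ ∘ (yz ,_)))
    unchanged _   _   ¬c₃ _        _        (yes zx) =
      rotated (rotated (tripleWeight-unchanged-in-block zx (¬c₃ ∘ (zx ,_))))
    unchanged _   _   _   (no ¬xy) (no ¬yz) (no ¬zx) = tripleWeight-cong G σ̂ σ
      (sameOrder-outside-blocks σ̂ σ σ̂-respects σ-respects ¬xy)
      (sameOrder-outside-blocks σ̂ σ σ̂-respects σ-respects ¬yz)
      (sameOrder-outside-blocks σ̂ σ σ̂-respects σ-respects ¬zx)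
    by-cases : (c₁ : Dec (Critical x y z)) (c₂ : Dec (Critical y z x)) (c₃ : Dec (Critical z x y)) →
      𝟙 (does c₁) + 𝟙 (does c₂) + 𝟙 (does c₃) ≡ 0 → tripleWeight G σ̂ x y z ≡ tripleWeight G σ x y z
    by-cases (no ¬c₁) (no ¬c₂) (no ¬c₃) _ =
      unchanged ¬c₁ ¬c₂ ¬c₃ (SameBlock? blk x y) (SameBlock? blk y z) (SameBlock? blk z x)
    by-cases (yes _)  _        _        ()
    by-cases (no _)   (yes _)  _        ()
    by-cases (no _)   (no _)   (yes _)  ()

  laterWeight : Ordering n → Fin n → Fin n → ℕ
  laterWeight τ x y = rm G m σM y (blk x) * ⟦ τ ⊢ x ≺ y ⟧ + rm G m σM x (blk x) * ⟦ τ ⊢ y ≺ x ⟧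

  critical-sum : ∀ τ → Respects blk τ → ∀ {x y} → SameBlock blk x y →
    sum (λ z → critical x y z * tripleWeight G τ x y z) ≡ laterWeight τ x y
  critical-sum τ (restricts , inBlock) {x} {y} same@(x∉M , y∉M , _ , βx≡βy) = begin
    sum (λ z → critical x y z * tripleWeight G τ x y z)
      ≡⟨ sum-cong-≗ pointwise ⟩
    sum (λ z → after z * (edge G y z * L₁ + edge G x z * L₂))
      ≡⟨ sum-cong-≗ (λ z → distrib (after z) (edge G y z) (edge G x z)) ⟩
    sum (λ z → after z * edge G y z * L₁ + after z * edge G x z * L₂)
      ≡⟨ ∑-distrib-+ {n} _ _ ⟩
    sum (λ z → after z * edge G y z * L₁) + sum (λ z → after z * edge G x z * L₂)
      ≡⟨ cong₂ _+_ (*-distribʳ-sum L₁ (λ z → after z * edge G y z))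
                   (*-distribʳ-sum L₂ (λ z → after z * edge G x z)) ⟨
    sum (λ z → after z * edge G y z) * L₁ + sum (λ z → after z * edge G x z) * L₂
      ≡⟨ cong₂ (λ r r' → r * L₁ + r' * L₂) (rm-as-sum y β) (rm-as-sum x β) ⟩
    laterWeight τ x y ∎
    where
    open ≡-Reasoning
    β = blk x
    L₁ = ⟦ τ ⊢ x ≺ y ⟧
    L₂ = ⟦ τ ⊢ y ≺ x ⟧
    after : Fin n → ℕ
    after z = 𝟙 (does (afterBlock? β z))
    distrib : ∀ a e e' → a * (e * L₁ + e' * L₂) ≡ a * e * L₁ + a * e' * L₂
    distrib a e e' =
      trans (*-distribˡ-+ a (e * L₁) (e' * L₂)) (sym (cong₂ _+_ (*-assoc a e L₁) (*-assoc a e' L₂)))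
    pointwise : ∀ z → critical x y z * tripleWeight G τ x y z ≡ after z * (edge G y z * L₁ + edge G x z * L₂)
    pointwise z = by-cases (afterBlock? β z)
      where
      by-cases : (d : Dec (AfterBlock β z)) →
        critical x y z * tripleWeight G τ x y z ≡ 𝟙 (does d) * (edge G y z * L₁ + edge G x z * L₂)
      by-cases (no ¬after) = cong (_* tripleWeight G τ x y z) (𝟙-no (critical? x y z) (¬after ∘ proj₂))
      by-cases (yes after@(j , refl , β≤j)) = cong₂ _*_ (𝟙-yes (critical? x y z) (same , after))
        (tripleWeight-last G τ (block≺m τ restricts (inBlock x x∉M) j β≤j)
                               (block≺m τ restricts (inBlock y y∉M) j
                                        (subst (λ β' → toℕ β' ≤ place j) βx≡βy β≤j)))

  laterWeight-≺ : ∀ τ {x y} → τ ⊢ x ≺ y → laterWeight τ x y ≡ rm G m σM y (blk x)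
  laterWeight-≺ τ {x} {y} x≺y = begin
    laterWeight τ x y
      ≡⟨ cong₂ (λ a b → rm G m σM y (blk x) * a + rm G m σM x (blk x) * b)
               (≺⇒⟦≺⟧≡1 τ x≺y) (≻⇒⟦≺⟧≡0 τ x≺y) ⟩
    rm G m σM y (blk x) * 1 + rm G m σM x (blk x) * 0
      ≡⟨ cong₂ _+_ (*-identityʳ (rm G m σM y (blk x))) (*-zeroʳ (rm G m σM x (blk x))) ⟩
    rm G m σM y (blk x) + 0
      ≡⟨ +-identityʳ (rm G m σM y (blk x)) ⟩
    rm G m σM y (blk x) ∎
    where open ≡-Reasoning

  laterWeight-sym : ∀ τ {x y} → blk x ≡ blk y → laterWeight τ x y ≡ laterWeight τ y x
  laterWeight-sym τ {x} {y} βx≡βy = begin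
    rm G m σM y (blk x) * ⟦ τ ⊢ x ≺ y ⟧ + rm G m σM x (blk x) * ⟦ τ ⊢ y ≺ x ⟧
      ≡⟨ +-comm (rm G m σM y (blk x) * ⟦ τ ⊢ x ≺ y ⟧) _ ⟩
    rm G m σM x (blk x) * ⟦ τ ⊢ y ≺ x ⟧ + rm G m σM y (blk x) * ⟦ τ ⊢ x ≺ y ⟧
      ≡⟨ cong (λ β → rm G m σM x β * ⟦ τ ⊢ y ≺ x ⟧ + rm G m σM y β * ⟦ τ ⊢ x ≺ y ⟧) βx≡βy ⟩
    laterWeight τ y x ∎
    where open ≡-Reasoning

  rm-later-≤ : ∀ {x y} → SameBlock blk x y → σ̂ ⊢ x ≺ y → rm G m σM y (blk x) ≤ rm G m σM x (blk x)
  rm-later-≤ {x} {y} (x∉M , y∉M , _ , βx≡βy) x≺̂y with cls x ≟ᶠ cls y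
  ... | yes same-class =
    ≤-reflexive (rm-cong (proj₁ (proj₂ classes y x y∉M x∉M) (sym same-class)) (blk x))
  ... | no different-class with <-cmp (toℕ (g (blk x) ⟨$⟩ˡ cls x)) (toℕ (g (blk x) ⟨$⟩ˡ cls y))
  ...   | tri< ix<iy _ _ =
          g-sorted (blk x) _ _ x y x∉M y∉M (sym (inverseʳ (g (blk x)))) (sym (inverseʳ (g (blk x)))) ix<iy
  ...   | tri≈ _ ix≡iy _ = ⊥-elim (different-class
          (Injection.injective (↔⇒↣ (flip (g (blk x)))) (toℕ-injective ix≡iy)))
  ...   | tri> _ _ iy<ix = ⊥-elim (<-asym x≺̂y (σ̂-sorted (blk x) y x _ _ y∉M x∉M
          (subst (InBlock σ m σM y) (sym βx≡βy) (blockOf-InBlock σ y∉M)) (blockOf-InBlock σ x∉M)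
          (sym (inverseʳ (g (blk x)))) (sym (inverseʳ (g (blk x)))) iy<ix))

  laterWeight-≤ : ∀ {x y} → SameBlock blk x y → laterWeight σ̂ x y ≤ laterWeight σ x y
  laterWeight-≤ {x} {y} same@(_ , _ , x≢y , βx≡βy) with ≺-total σ̂ x≢y | ≺-total σ x≢y
  ... | inj₁ x≺̂y | inj₁ x≺y = ≤-reflexive (trans (laterWeight-≺ σ̂ x≺̂y) (sym (laterWeight-≺ σ x≺y)))
  ... | inj₂ y≺̂x | inj₂ y≺x = ≤-reflexive (begin-equality
    laterWeight σ̂ x y ≡⟨ laterWeight-sym σ̂ βx≡βy ⟩
    laterWeight σ̂ y x ≡⟨ laterWeight-≺ σ̂ y≺̂x ⟩
    rm G m σM x (blk y) ≡⟨ laterWeight-≺ σ y≺x ⟨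
    laterWeight σ y x ≡⟨ laterWeight-sym σ βx≡βy ⟨
    laterWeight σ x y ∎)
    where open ≤-Reasoning
  ... | inj₁ x≺̂y | inj₂ y≺x = begin
    laterWeight σ̂ x y   ≡⟨ laterWeight-≺ σ̂ x≺̂y ⟩
    rm G m σM y (blk x) ≤⟨ rm-later-≤ same x≺̂y ⟩
    rm G m σM x (blk x) ≡⟨ cong (rm G m σM x) βx≡βy ⟩
    rm G m σM x (blk y) ≡⟨ laterWeight-≺ σ y≺x ⟨
    laterWeight σ y x   ≡⟨ laterWeight-sym σ βx≡βy ⟨
    laterWeight σ x y   ∎
    where open ≤-Reasoning
  ... | inj₂ y≺̂x | inj₁ x≺y = begin
    laterWeight σ̂ x y   ≡⟨ laterWeight-sym σ̂ βx≡βy ⟩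
    laterWeight σ̂ y x   ≡⟨ laterWeight-≺ σ̂ y≺̂x ⟩
    rm G m σM x (blk y) ≤⟨ rm-later-≤ (SameBlock-sym same) y≺̂x ⟩
    rm G m σM y (blk y) ≡⟨ cong (rm G m σM y) βx≡βy ⟨
    rm G m σM y (blk x) ≡⟨ laterWeight-≺ σ x≺y ⟨
    laterWeight σ x y   ∎
    where open ≤-Reasoning

  critical-weight-≤ : Σ3 (λ x y z → critical x y z * tripleWeight G σ̂ x y z)
                    ≤ Σ3 (λ x y z → critical x y z * tripleWeight G σ x y z)
  critical-weight-≤ = sum-mono-≤ λ x → sum-mono-≤ λ y → by-cases x y (SameBlock? blk x y)
    where
    by-cases : ∀ x y → Dec (SameBlock blk x y) →
      sum (λ z → critical x y z * tripleWeight G σ̂ x y z) ≤ sum (λ z → critical x y z * tripleWeight G σ x y z)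
    by-cases x y (yes same) = begin
      sum (λ z → critical x y z * tripleWeight G σ̂ x y z) ≡⟨ critical-sum σ̂ σ̂-respects same ⟩
      laterWeight σ̂ x y                                    ≤⟨ laterWeight-≤ same ⟩
      laterWeight σ x y                                    ≡⟨ critical-sum σ σ-respects same ⟨
      sum (λ z → critical x y z * tripleWeight G σ x y z)  ∎
      where open ≤-Reasoning
    by-cases x y (no ¬same) = ≤-reflexive (trans (vanishes σ̂) (sym (vanishes σ)))
      where
      vanishes : ∀ τ → sum (λ z → critical x y z * tripleWeight G τ x y z) ≡ 0
      vanishes τ =
        sum-zero λ z → cong (_* tripleWeight G τ x y z) (𝟙-no (critical? x y z) (¬same ∘ proj₁))

lemma6 : ∀ {n k ℓ : ℕ} (G : SimpleGraph n) (m : Fin k → Fin n) (cls : Fin n → Fin ℓ)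
    → Injective _≡_ _≡_ m
    → IsCliqueModulator G m
    → IsClassLabelling G m cls
    → (σM : Permutation′ k)
    → (g : Fin (suc k) → Permutation′ ℓ)
    → (∀ b j j' u w → InQ m u → InQ m w
         → cls u ≡ g b ⟨$⟩ʳ j → cls w ≡ g b ⟨$⟩ʳ j' → toℕ j < toℕ j'
         → rm G m σM u b ≥ rm G m σM w b)
    → (σ : Ordering n) → RestrictsTo σ m σM
    → (σ̂ : Ordering n) → RestrictsTo σ̂ m σM
    → (∀ u b → InQ m u → (InBlock σ m σM u b → InBlock σ̂ m σM u b)
                        × (InBlock σ̂ m σM u b → InBlock σ m σM u b))
    → (∀ b u w j j' → InQ m u → InQ m w
         → InBlock σ m σM u b → InBlock σ m σM w b
         → cls u ≡ g b ⟨$⟩ʳ j → cls w ≡ g b ⟨$⟩ʳ j' → toℕ j < toℕ j'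
         → σ̂ ⊢ u ≺ w)
    → cost G σ̂ ≤ cost G σ
lemma6 G m cls m-injective clique classes σM g g-sorted σ σ-restricts σ̂ σ̂-restricts same-blocks σ̂-sorted =
  cost-≤-by-tripleWeight G σ̂ σ
    (Σ3-≤-outside-cyclic-support critical (tripleWeight G σ̂) (tripleWeight G σ)
      (tripleWeight-cyclic G σ̂) (tripleWeight-cyclic G σ)
      cyclicSum-critical≤1 tripleWeight-unchanged critical-weight-≤)
  where
  open Exchange G m cls m-injective clique classes σM g g-sorted σ σ-restricts σ̂ σ̂-restricts same-blocks σ̂-sorted
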